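{- Let $X$ be a nonempty set and let $\mathcal{U}=\{A_1,\dots,A_n\}$ be a partition of $X$ into $n$ sets with $n\ge4$. Then $$S_{\mathcal{U}}(C_\infty(\mathcal{U}))=\begin{cases}\lfloor \log_2 n\rfloor & \text{if } n\le 1+3\cdot 2^{\lfloor \log_2 n\rfloor-1},\\ \lceil \log_2 n\rceil & \text{if } n> 1+3\cdot 2^{\lfloor \log_2 n\rfloor-1}.\end{cases}$$
   Context: A partition of $X$ is a family of nonempty pairwise disjoint subsets whose union is $X$. For a family $\mathcal{U}$ of subsets of $X$, let $C_1(\mathcal{U})$ be the family of all sets of the form $E_1\cap E_2$, $E_1\cup E_2$ or $X\setminus E_1$ with $E_1,E_2\in\mathcal{U}$ (possibly $E_1=E_2$). Set $C_0(\mathcal{U})=\mathcal{U}$, $C_n(\mathcal{U})=C_1(C_{n-1}(\mathcal{U}))$ for $n\ge1$, and $C_\infty(\mathcal{U})=\bigcup_{n\ge1}C_n(\mathcal{U})$. For families $\mathcal{U},\mathcal{H}$, $S_{\mathcal{U}}(\mathcal{H})=\inf\{n\ge0:\mathcal{H}\subseteq C_n(\mathcal{U})\}$ (with $\inf\emptyset=\infty$). -}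

module Defs where

open import Data.Nat using (ℕ; zero; suc; _<_; _≤_; _∸_; _^_; _+_; _*_)
open import Data.Bool using (Bool; true; false; _∧_; _∨_; not)
open import Data.Fin using (Fin)
open import Data.Product using (Σ; ∃; _×_; _,_)
open import Data.Sum using (_⊎_)
open import Relation.Nullary using (¬_)
open import Relation.Binary.PropositionalEquality using (_≡_; _≢_)

-- Subsets of X, represented by characteristic functions X → Bool
-- (classically, every subset of X is of this form).
Subset : Set → Set
Subset X = X → Bool

_≐_ : {X : Set} → Subset X → Subset X → Set
E ≐ F = ∀ x → E x ≡ F x

_∩_ : {X : Set} → Subset X → Subset X → Subset X
(E ∩ F) x = E x ∧ F x

_∪_ : {X : Set} → Subset X → Subset X → Subset X
(E ∪ F) x = E x ∨ F x

∁ : {X : Set} → Subset X → Subset X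
∁ E x = not (E x)

-- A family of subsets of X: a predicate on subsets (membership).
-- All families used below are closed under extensional equality ≐.
Family : Set → Set₁
Family X = Subset X → Set

familyOf : {X : Set} {n : ℕ} → (Fin n → Subset X) → Family X
familyOf A E = ∃ λ i → E ≐ A i

IsPartition : {X : Set} {n : ℕ} → (Fin n → Subset X) → Set
IsPartition {X} {n} A =
  (∀ i → ∃ λ x → A i x ≡ true)
  × (∀ i j → i ≢ j → ∀ x → A i x ≡ true → A j x ≡ true → Data.Empty.⊥)
  × (∀ x → ∃ λ i → A i x ≡ true)
  where import Data.Empty

C₁ : {X : Set} → Family X → Family X
C₁ 𝒰 E = ∃ λ E₁ → ∃ λ E₂ → 𝒰 E₁ × 𝒰 E₂ ×
           ((E ≐ (E₁ ∩ E₂)) ⊎ (E ≐ (E₁ ∪ E₂)) ⊎ (E ≐ ∁ E₁))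

C : {X : Set} → ℕ → Family X → Family X
C zero    𝒰 = 𝒰
C (suc n) 𝒰 = C₁ (C n 𝒰)

C∞ : {X : Set} → Family X → Family X
C∞ 𝒰 E = ∃ λ n → 1 ≤ n × C n 𝒰 E

_⊆F_ : {X : Set} → Family X → Family X → Set
ℋ ⊆F 𝒢 = ∀ E → ℋ E → 𝒢 E

-- S_𝒰(ℋ) = k : k is the least n ≥ 0 with ℋ ⊆ Cₙ(𝒰)
-- (the infimum is attained and equals the natural number k).
S-is : {X : Set} → Family X → Family X → ℕ → Set
S-is 𝒰 ℋ k = (ℋ ⊆F C k 𝒰) × (∀ m → m < k → ¬ (ℋ ⊆F C m 𝒰))

-- A set of Cₘ(𝒰) is a union of blocks, so it is determined by its set of block
-- indices p ⊆ Fin n, and ∩, ∪, ∁ act on these index sets. By de Morgan, sets of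
-- Cₘ(𝒰) with m ≥ 2 consist of at most 2ᵐ blocks or miss at most 2ᵐ⁻¹ blocks.
-- Conversely, by halving, every union of at most 2ᵐ blocks lies in Cₘ(𝒰), and
-- by complementation so does every union missing at most 2ᵐ⁻¹ blocks. Hence,
-- for m ≥ 2, C∞(𝒰) ⊆ Cₘ(𝒰) exactly when n ≤ 1 + 3·2ᵐ⁻¹, while X ∉ C₁(𝒰);
-- comparing this threshold with the powers of two gives the two cases.
module Submission where

open import Defs
open import Data.Nat using (ℕ; _≤_; _>_; _∸_; _^_; _+_; _*_)
open import Data.Nat.Logarithm using (⌊log₂_⌋; ⌈log₂_⌉)
open import Data.Fin using (Fin)
open import Data.Product using (_×_)

open import Data.Nat using (zero; suc; _<_; _≤′_; ≤′-refl; ≤′-step; z≤n; s≤s; s≤s⁻¹; ⌊_/2⌋; ⌈_/2⌉; _≟_; _≤?_)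
open import Data.Nat.Properties
open import Data.Nat.Induction using (<-rec)
open import Data.Nat.Logarithm
  using (⌊log₂⌋-mono-≤; ⌈log₂⌉-mono-≤; ⌊log₂[2^n]⌋≡n; ⌈log₂2^n⌉≡n; ⌊log₂⌊n/2⌋⌋≡⌊log₂n⌋∸1; ⌈log₂⌈n/2⌉⌉≡⌈log₂n⌉∸1)
open import Data.Nat.Tactic.RingSolver using (solve-∀)
open import Data.Fin using (zero; suc) renaming (_≟_ to _≟ᶠ_)
import Data.Fin.Subset as Sub
open Sub using (∣_∣; ⁅_⁆; inside; outside)
open import Data.Fin.Subset.Properties
  using (∣p∩q∣≤∣p∣; ∣p∩q∣≤∣q∣; ∣∁p∣≡n∸∣p∣; ∣⊥∣≡0; ∣⊤∣≡n; ∣⁅x⁆∣≡1; x∈⁅x⁆; x∈⁅y⁆⇒x≡y; ∪-∩-booleanAlgebra)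
import Algebra.Lattice.Properties.BooleanAlgebra as BooleanAlgebraProperties
open import Data.Vec using (_∷_; []; lookup; tabulate)
open import Data.Vec.Properties
  using (lookup-zipWith; lookup-map; lookup-replicate; []=⇒lookup; lookup⇒[]=; tabulate∘lookup; tabulate-cong)
open import Data.Bool using (true; false; _∧_; _∨_; not)
open import Data.Bool.Properties using (∧-idem; not-involutive)
open import Data.Product using (∃; ∃₂; _,_; proj₁; proj₂)
open import Data.Sum using (_⊎_; inj₁; inj₂)
import Data.Sum as Sum
import Data.Product as Product
open import Data.Empty using (⊥-elim)
open import Relation.Nullary using (¬_; yes; no)
open import Relation.Binary.PropositionalEquality

private
  variable
    X : Set
    n m : ℕ
    E F G : Subset X

module BA {n : ℕ} = BooleanAlgebraProperties (∪-∩-booleanAlgebra n)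
  using (deMorgan₁; deMorgan₂; ¬-involutive)

∣p∪q∣≤∣p∣+∣q∣ : (p q : Sub.Subset n) → ∣ p Sub.∪ q ∣ ≤ ∣ p ∣ + ∣ q ∣
∣p∪q∣≤∣p∣+∣q∣ [] [] = z≤n
∣p∪q∣≤∣p∣+∣q∣ (inside ∷ p) (inside ∷ q) =
  s≤s (≤-trans (∣p∪q∣≤∣p∣+∣q∣ p q) (+-monoʳ-≤ ∣ p ∣ (n≤1+n ∣ q ∣)))
∣p∪q∣≤∣p∣+∣q∣ (inside ∷ p) (outside ∷ q) = s≤s (∣p∪q∣≤∣p∣+∣q∣ p q)
∣p∪q∣≤∣p∣+∣q∣ (outside ∷ p) (inside ∷ q) =
  ≤-trans (s≤s (∣p∪q∣≤∣p∣+∣q∣ p q)) (≤-reflexive (sym (+-suc ∣ p ∣ ∣ q ∣)))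
∣p∪q∣≤∣p∣+∣q∣ (outside ∷ p) (outside ∷ q) = ∣p∪q∣≤∣p∣+∣q∣ p q

∣p∣≡0⇒p≡⊥ : (p : Sub.Subset n) → ∣ p ∣ ≡ 0 → p ≡ Sub.⊥
∣p∣≡0⇒p≡⊥ [] _ = refl
∣p∣≡0⇒p≡⊥ (outside ∷ p) ∣p∣≡0 = cong (outside ∷_) (∣p∣≡0⇒p≡⊥ p ∣p∣≡0)

∣p∣≡1⇒p≡⁅x⁆ : (p : Sub.Subset n) → ∣ p ∣ ≡ 1 → ∃ λ i → p ≡ ⁅ i ⁆
∣p∣≡1⇒p≡⁅x⁆ (inside ∷ p) ∣p∣≡1 = zero , cong (inside ∷_) (∣p∣≡0⇒p≡⊥ p (suc-injective ∣p∣≡1))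
∣p∣≡1⇒p≡⁅x⁆ (outside ∷ p) ∣p∣≡1 = Product.map suc (cong (outside ∷_)) (∣p∣≡1⇒p≡⁅x⁆ p ∣p∣≡1)

∪-split : ∀ a b (p : Sub.Subset n) → ∣ p ∣ ≡ a + b →
          ∃₂ λ q r → p ≡ q Sub.∪ r × ∣ q ∣ ≡ a × ∣ r ∣ ≡ b
∪-split zero zero [] refl = [] , [] , refl , refl , refl
∪-split a b (outside ∷ p) ∣p∣≡a+b with ∪-split a b p ∣p∣≡a+b
... | q , r , refl , ∣q∣≡a , ∣r∣≡b = outside ∷ q , outside ∷ r , refl , ∣q∣≡a , ∣r∣≡b
∪-split (suc a) b (inside ∷ p) ∣p∣≡a+b with ∪-split a b p (suc-injective ∣p∣≡a+b)
... | q , r , refl , ∣q∣≡a , ∣r∣≡b = inside ∷ q , outside ∷ r , refl , cong suc ∣q∣≡a , ∣r∣≡b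
∪-split zero (suc b) (inside ∷ p) ∣p∣≡a+b with ∪-split zero b p (suc-injective ∣p∣≡a+b)
... | q , r , refl , ∣q∣≡a , ∣r∣≡b = outside ∷ q , inside ∷ r , refl , ∣q∣≡a , cong suc ∣r∣≡b

∃-subset-of-size : ∀ {c} → c ≤ n → ∃ λ (p : Sub.Subset n) → ∣ p ∣ ≡ c
∃-subset-of-size {n} z≤n = Sub.⊥ , ∣⊥∣≡0 n
∃-subset-of-size (s≤s c≤n) = Product.map (inside ∷_) (cong suc) (∃-subset-of-size c≤n)

≐-trans : E ≐ F → F ≐ G → E ≐ G
≐-trans E≐F F≐G x = trans (E≐F x) (F≐G x)

C₁-respects-≐ : {𝒰 : Family X} → E ≐ F → C₁ 𝒰 F → C₁ 𝒰 E
C₁-respects-≐ E≐F (E₁ , E₂ , h₁ , h₂ , F≐) =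
  E₁ , E₂ , h₁ , h₂ , Sum.map (≐-trans E≐F) (Sum.map (≐-trans E≐F) (≐-trans E≐F)) F≐

C-mono : {𝒰 : Family X} → ∀ m → C m 𝒰 E → C (suc m) 𝒰 E
C-mono {E = E} m E∈C = E , E , E∈C , E∈C , inj₁ (λ x → sym (∧-idem (E x)))

C-mono-≤′ : ∀ {𝒰 : Family X} {m m′} → m ≤′ m′ → C m 𝒰 E → C m′ 𝒰 E
C-mono-≤′ ≤′-refl E∈C = E∈C
C-mono-≤′ {m′ = suc m′} (≤′-step m≤′m′) E∈C = C-mono m′ (C-mono-≤′ m≤′m′ E∈C)

C-mono-≤ : ∀ {𝒰 : Family X} {m m′} → m ≤ m′ → C m 𝒰 E → C m′ 𝒰 E
C-mono-≤ m≤m′ = C-mono-≤′ (≤⇒≤′ m≤m′)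

S-is-suc : {𝒰 ℋ : Family X} → ℋ ⊆F C (suc m) 𝒰 → ¬ (ℋ ⊆F C m 𝒰) → S-is 𝒰 ℋ (suc m)
S-is-suc ℋ⊆Cm+1 ℋ⊈Cm = ℋ⊆Cm+1 , λ m′ m′<m+1 ℋ⊆Cm′ →
  ℋ⊈Cm (λ E E∈ℋ → C-mono-≤ (s≤s⁻¹ m′<m+1) (ℋ⊆Cm′ E E∈ℋ))

m≤2*m : ∀ m → m ≤ 2 * m
m≤2*m m = m≤n*m m 2

2*m≡m+m : ∀ m → 2 * m ≡ m + m
2*m≡m+m m = cong (m +_) (+-identityʳ m)

1+3m≡[1+2m]+m : ∀ m → 1 + 3 * m ≡ (1 + 2 * m) + m
1+3m≡[1+2m]+m = solve-∀

SmallOrCosmall : ℕ → Sub.Subset n → Set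
SmallOrCosmall H p = ∣ p ∣ ≤ 2 * H ⊎ ∣ Sub.∁ p ∣ ≤ H


small-∩ : ∀ {H} (p q : Sub.Subset n) → SmallOrCosmall H p → SmallOrCosmall H q →
          SmallOrCosmall (2 * H) (p Sub.∩ q)
small-∩ p q (inj₁ p-small) _ = inj₁ (≤-trans (∣p∩q∣≤∣p∣ p q) (≤-trans p-small (m≤2*m _)))
small-∩ p q (inj₂ _) (inj₁ q-small) = inj₁ (≤-trans (∣p∩q∣≤∣q∣ p q) (≤-trans q-small (m≤2*m _)))
small-∩ {H = H} p q (inj₂ p-cosmall) (inj₂ q-cosmall) = inj₂ (begin
  ∣ Sub.∁ (p Sub.∩ q) ∣          ≡⟨ cong ∣_∣ (BA.deMorgan₁ p q) ⟩
  ∣ Sub.∁ p Sub.∪ Sub.∁ q ∣      ≤⟨ ∣p∪q∣≤∣p∣+∣q∣ (Sub.∁ p) (Sub.∁ q) ⟩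
  ∣ Sub.∁ p ∣ + ∣ Sub.∁ q ∣      ≤⟨ +-mono-≤ p-cosmall q-cosmall ⟩
  H + H                          ≡⟨ sym (2*m≡m+m H) ⟩
  2 * H                          ∎)
  where open ≤-Reasoning

small-∪ : ∀ {H} (p q : Sub.Subset n) → SmallOrCosmall H p → SmallOrCosmall H q →
          SmallOrCosmall (2 * H) (p Sub.∪ q)
small-∪ {H = H} p q (inj₁ p-small) (inj₁ q-small) = inj₁ (begin
  ∣ p Sub.∪ q ∣      ≤⟨ ∣p∪q∣≤∣p∣+∣q∣ p q ⟩
  ∣ p ∣ + ∣ q ∣      ≤⟨ +-mono-≤ p-small q-small ⟩
  2 * H + 2 * H      ≡⟨ sym (2*m≡m+m (2 * H)) ⟩
  2 * (2 * H)        ∎)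
  where open ≤-Reasoning
small-∪ {H = H} p q (inj₂ p-cosmall) _ = inj₂ (begin
  ∣ Sub.∁ (p Sub.∪ q) ∣          ≡⟨ cong ∣_∣ (BA.deMorgan₂ p q) ⟩
  ∣ Sub.∁ p Sub.∩ Sub.∁ q ∣      ≤⟨ ∣p∩q∣≤∣p∣ (Sub.∁ p) (Sub.∁ q) ⟩
  ∣ Sub.∁ p ∣                    ≤⟨ ≤-trans p-cosmall (m≤2*m _) ⟩
  2 * H                          ∎)
  where open ≤-Reasoning
small-∪ {H = H} p q (inj₁ _) (inj₂ q-cosmall) = inj₂ (begin
  ∣ Sub.∁ (p Sub.∪ q) ∣          ≡⟨ cong ∣_∣ (BA.deMorgan₂ p q) ⟩
  ∣ Sub.∁ p Sub.∩ Sub.∁ q ∣      ≤⟨ ∣p∩q∣≤∣q∣ (Sub.∁ p) (Sub.∁ q) ⟩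
  ∣ Sub.∁ q ∣                    ≤⟨ ≤-trans q-cosmall (m≤2*m _) ⟩
  2 * H                          ∎)
  where open ≤-Reasoning

small-∁ : ∀ {H} (p : Sub.Subset n) → SmallOrCosmall H p → SmallOrCosmall (2 * H) (Sub.∁ p)
small-∁ p (inj₁ p-small) = inj₂ (subst (_≤ _) (cong ∣_∣ (sym (BA.¬-involutive p))) p-small)
small-∁ p (inj₂ p-cosmall) = inj₁ (≤-trans p-cosmall (≤-trans (m≤2*m _) (m≤2*m _)))

-- The shape of the index set of a member of Cₘ(𝒰). Level 1 is kept exact
-- (all blocks but exactly one), since that is what excludes X from C₁(𝒰).
Admissible : ℕ → Sub.Subset n → Set
Admissible zero p = ∣ p ∣ ≡ 1
Admissible (suc zero) p = ∣ p ∣ ≤ 2 ⊎ ∣ Sub.∁ p ∣ ≡ 1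
Admissible (suc (suc d)) p = SmallOrCosmall (2 ^ suc d) p

admissible₁⇒smallOrCosmall : (p : Sub.Subset n) → Admissible 1 p → SmallOrCosmall 1 p
admissible₁⇒smallOrCosmall p = Sum.map₂ ≤-reflexive

admissible-∩ : ∀ m (p q : Sub.Subset n) → Admissible m p → Admissible m q →
               Admissible (suc m) (p Sub.∩ q)
admissible-∩ zero p q ∣p∣≡1 _ = inj₁ (≤-trans (∣p∩q∣≤∣p∣ p q) (≤-trans (≤-reflexive ∣p∣≡1) (n≤1+n 1)))
admissible-∩ (suc zero) p q p-adm q-adm =
  small-∩ p q (admissible₁⇒smallOrCosmall p p-adm) (admissible₁⇒smallOrCosmall q q-adm)
admissible-∩ (suc (suc d)) p q = small-∩ p q

admissible-∪ : ∀ m (p q : Sub.Subset n) → Admissible m p → Admissible m q →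
               Admissible (suc m) (p Sub.∪ q)
admissible-∪ zero p q ∣p∣≡1 ∣q∣≡1 = inj₁ (≤-trans (∣p∪q∣≤∣p∣+∣q∣ p q) (≤-reflexive (cong₂ _+_ ∣p∣≡1 ∣q∣≡1)))
admissible-∪ (suc zero) p q p-adm q-adm =
  small-∪ p q (admissible₁⇒smallOrCosmall p p-adm) (admissible₁⇒smallOrCosmall q q-adm)
admissible-∪ (suc (suc d)) p q = small-∪ p q

admissible-∁ : ∀ m (p : Sub.Subset n) → Admissible m p → Admissible (suc m) (Sub.∁ p)
admissible-∁ zero p ∣p∣≡1 = inj₂ (trans (cong ∣_∣ (BA.¬-involutive p)) ∣p∣≡1)
admissible-∁ (suc zero) p p-adm = small-∁ p (admissible₁⇒smallOrCosmall p p-adm)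
admissible-∁ (suc (suc d)) p = small-∁ p

⊤-not-admissible₁ : 3 ≤ n → ¬ Admissible 1 (Sub.⊤ {n})
⊤-not-admissible₁ {n} 3≤n (inj₁ ∣⊤∣≤2) = <⇒≱ 3≤n (subst (_≤ 2) (∣⊤∣≡n n) ∣⊤∣≤2)
⊤-not-admissible₁ {n} _ (inj₂ ∣∁⊤∣≡1) = 0≢1+n (begin
  0                       ≡⟨ sym (n∸n≡0 n) ⟩
  n ∸ n                   ≡⟨ cong (n ∸_) (sym (∣⊤∣≡n n)) ⟩
  n ∸ ∣ Sub.⊤ {n} ∣       ≡⟨ sym (∣∁p∣≡n∸∣p∣ (Sub.⊤ {n})) ⟩
  ∣ Sub.∁ (Sub.⊤ {n}) ∣   ≡⟨ ∣∁⊤∣≡1 ⟩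
  1                       ∎)
  where open ≡-Reasoning

neither-small-nor-cosmall : ∀ {H} (p : Sub.Subset n) → 1 + 3 * H < n → ∣ p ∣ ≡ 1 + 2 * H →
                            ¬ SmallOrCosmall H p
neither-small-nor-cosmall p _ ∣p∣≡ (inj₁ p-small) = <-irrefl refl (subst (_≤ _) ∣p∣≡ p-small)
neither-small-nor-cosmall {n} {H} p 1+3H<n ∣p∣≡ (inj₂ p-cosmall) = <⇒≱ 1+3H<n (begin
  n                      ≤⟨ m≤n+m∸n n ∣ p ∣ ⟩
  ∣ p ∣ + (n ∸ ∣ p ∣)    ≤⟨ +-monoʳ-≤ ∣ p ∣ (subst (_≤ H) (∣∁p∣≡n∸∣p∣ p) p-cosmall) ⟩
  ∣ p ∣ + H              ≡⟨ cong (_+ H) ∣p∣≡ ⟩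
  (1 + 2 * H) + H        ≡⟨ sym (1+3m≡[1+2m]+m H) ⟩
  1 + 3 * H              ∎)
  where open ≤-Reasoning

module Partition {X : Set} {n : ℕ} (A : Fin n → Subset X) (partition : IsPartition A) where

  𝒰 : Family X
  𝒰 = familyOf A

  blockOf : X → Fin n
  blockOf x = proj₁ (proj₂ (proj₂ partition) x)

  x∈A[blockOf-x] : ∀ x → A (blockOf x) x ≡ true
  x∈A[blockOf-x] x = proj₂ (proj₂ (proj₂ partition) x)

  blockOf-unique : ∀ {i x} → A i x ≡ true → blockOf x ≡ i
  blockOf-unique {i} {x} x∈Ai with blockOf x ≟ᶠ i
  ... | yes blockOf-x≡i = blockOf-x≡i
  ... | no blockOf-x≢i = ⊥-elim (proj₁ (proj₂ partition) _ _ blockOf-x≢i x (x∈A[blockOf-x] x) x∈Ai)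

  point : Fin n → X
  point i = proj₁ (proj₁ partition i)

  blockOf-point : ∀ i → blockOf (point i) ≡ i
  blockOf-point i = blockOf-unique (proj₂ (proj₁ partition i))

  ⋃ : Sub.Subset n → Subset X
  ⋃ p x = lookup p (blockOf x)

  ⋃-∩ : ∀ p q → ⋃ (p Sub.∩ q) ≐ (⋃ p ∩ ⋃ q)
  ⋃-∩ p q x = lookup-zipWith _∧_ (blockOf x) p q

  ⋃-∪ : ∀ p q → ⋃ (p Sub.∪ q) ≐ (⋃ p ∪ ⋃ q)
  ⋃-∪ p q x = lookup-zipWith _ (blockOf x) p q

  ⋃-∁ : ∀ p → ⋃ (Sub.∁ p) ≐ ∁ (⋃ p)
  ⋃-∁ p x = lookup-map (blockOf x) not p

  ⋃-⁅⁆ : ∀ i → ⋃ ⁅ i ⁆ ≐ A i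
  ⋃-⁅⁆ i x with A i x in x∈Ai | lookup ⁅ i ⁆ (blockOf x) in lookup≡
  ... | true  | true  = refl
  ... | false | false = refl
  ... | true  | false = trans (sym lookup≡) (subst (λ j → lookup ⁅ i ⁆ j ≡ true)
                          (sym (blockOf-unique x∈Ai)) ([]=⇒lookup (x∈⁅x⁆ i)))
  ... | false | true  = trans (sym (x∈A[blockOf-x] x))
                          (trans (cong (λ j → A j x) (x∈⁅y⁆⇒x≡y i (lookup⇒[]= _ _ lookup≡))) x∈Ai)

  ⋃-injective : ∀ {p q} → ⋃ p ≐ ⋃ q → p ≡ q
  ⋃-injective {p} {q} ⋃p≐⋃q = begin
    p                   ≡⟨ sym (tabulate∘lookup p) ⟩
    tabulate (lookup p) ≡⟨ tabulate-cong lookup-p≗lookup-q ⟩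
    tabulate (lookup q) ≡⟨ tabulate∘lookup q ⟩
    q                   ∎
    where
    open ≡-Reasoning
    lookup-p≗lookup-q : ∀ i → lookup p i ≡ lookup q i
    lookup-p≗lookup-q i = subst (λ j → lookup p j ≡ lookup q j) (blockOf-point i) (⋃p≐⋃q (point i))

  C⇒⋃ : ∀ m {E} → C m 𝒰 E → ∃ λ p → E ≐ ⋃ p × Admissible m p
  C⇒⋃ zero (i , E≐Ai) = ⁅ i ⁆ , ≐-trans E≐Ai (λ x → sym (⋃-⁅⁆ i x)) , ∣⁅x⁆∣≡1 i
  C⇒⋃ (suc m) (E₁ , E₂ , E₁∈C , E₂∈C , E≐) with C⇒⋃ m E₁∈C | C⇒⋃ m E₂∈C | E≐
  ... | p , E₁≐⋃p , p-adm | q , E₂≐⋃q , q-adm | inj₁ E≐E₁∩E₂ =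
    p Sub.∩ q ,
    (λ x → trans (E≐E₁∩E₂ x) (trans (cong₂ _∧_ (E₁≐⋃p x) (E₂≐⋃q x)) (sym (⋃-∩ p q x)))) ,
    admissible-∩ m p q p-adm q-adm
  ... | p , E₁≐⋃p , p-adm | q , E₂≐⋃q , q-adm | inj₂ (inj₁ E≐E₁∪E₂) =
    p Sub.∪ q ,
    (λ x → trans (E≐E₁∪E₂ x) (trans (cong₂ _∨_ (E₁≐⋃p x) (E₂≐⋃q x)) (sym (⋃-∪ p q x)))) ,
    admissible-∪ m p q p-adm q-adm
  ... | p , E₁≐⋃p , p-adm | _ | inj₂ (inj₂ E≐∁E₁) =
    Sub.∁ p ,
    (λ x → trans (E≐∁E₁ x) (trans (cong not (E₁≐⋃p x)) (sym (⋃-∁ p x)))) ,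
    admissible-∁ m p p-adm

  S-is-C∞ : ∀ m → (∀ p → C (suc m) 𝒰 (⋃ p)) → (q : Sub.Subset n) → ¬ Admissible m q →
            S-is 𝒰 (C∞ 𝒰) (suc m)
  S-is-C∞ m ⋃∈C q q-inadmissible = S-is-suc C∞⊆C C∞⊈C
    where
    C∞⊆C : C∞ 𝒰 ⊆F C (suc m) 𝒰
    C∞⊆C E (k , _ , E∈C) = let p , E≐⋃p , _ = C⇒⋃ k E∈C in C₁-respects-≐ E≐⋃p (⋃∈C p)
    C∞⊈C : ¬ (C∞ 𝒰 ⊆F C m 𝒰)
    C∞⊈C C∞⊆C with C⇒⋃ m (C∞⊆C (⋃ q) (suc m , s≤s z≤n , ⋃∈C q))
    ... | p , ⋃q≐⋃p , p-adm = q-inadmissible (subst (Admissible m) (sym (⋃-injective ⋃q≐⋃p)) p-adm)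

  module _ {i j : Fin n} (i≢j : i ≢ j) where

    ⋃⊥∈C₁ : C 1 𝒰 (⋃ Sub.⊥)
    ⋃⊥∈C₁ = A i , A j , (i , λ _ → refl) , (j , λ _ → refl) , inj₁ Ai∩Aj≐∅
      where
      Ai∩Aj≐∅ : ∀ x → ⋃ Sub.⊥ x ≡ A i x ∧ A j x
      Ai∩Aj≐∅ x with A i x in x∈Ai | A j x in x∈Aj
      ... | false | _     = lookup-replicate (blockOf x) false
      ... | true  | false = lookup-replicate (blockOf x) false
      ... | true  | true  = ⊥-elim (i≢j (trans (sym (blockOf-unique x∈Ai)) (blockOf-unique x∈Aj)))

    nonempty-⋃∈C : ∀ d p → 1 ≤ ∣ p ∣ → ∣ p ∣ ≤ 2 ^ d → C d 𝒰 (⋃ p)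
    nonempty-⋃∈C zero p 1≤∣p∣ ∣p∣≤1 with ∣p∣≡1⇒p≡⁅x⁆ p (≤-antisym ∣p∣≤1 1≤∣p∣)
    ... | k , refl = k , ⋃-⁅⁆ k
    nonempty-⋃∈C (suc d) p 1≤∣p∣ ∣p∣≤2^[1+d] with ∣ p ∣ ≤? 2 ^ d
    ... | yes ∣p∣≤2^d = C-mono d (nonempty-⋃∈C d p 1≤∣p∣ ∣p∣≤2^d)
    ... | no ∣p∣≰2^d with ∪-split (2 ^ d) (∣ p ∣ ∸ 2 ^ d) p (sym (m+[n∸m]≡n (<⇒≤ (≰⇒> ∣p∣≰2^d))))
    ... | q , r , refl , ∣q∣≡2^d , ∣r∣≡∣p∣∸2^d =
      ⋃ q , ⋃ r , nonempty-⋃∈C d q 1≤∣q∣ (≤-reflexive ∣q∣≡2^d) , nonempty-⋃∈C d r 1≤∣r∣ ∣r∣≤2^d ,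
      inj₂ (inj₁ (⋃-∪ q r))
      where
      1≤∣q∣ : 1 ≤ ∣ q ∣
      1≤∣q∣ = subst (1 ≤_) (sym ∣q∣≡2^d) (m^n>0 2 d)
      1≤∣r∣ : 1 ≤ ∣ r ∣
      1≤∣r∣ = subst (1 ≤_) (sym ∣r∣≡∣p∣∸2^d) (m<n⇒0<n∸m (≰⇒> ∣p∣≰2^d))
      ∣r∣≤2^d : ∣ r ∣ ≤ 2 ^ d
      ∣r∣≤2^d = subst (_≤ 2 ^ d) (sym ∣r∣≡∣p∣∸2^d)
        (m≤n+o⇒m∸n≤o ∣ q Sub.∪ r ∣ (2 ^ d) (subst (∣ q Sub.∪ r ∣ ≤_) (2*m≡m+m (2 ^ d)) ∣p∣≤2^[1+d]))

    ⋃∈C : ∀ d p → ∣ p ∣ ≤ 2 ^ suc d → C (suc d) 𝒰 (⋃ p)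
    ⋃∈C d p ∣p∣≤2^[1+d] with ∣ p ∣ ≟ 0
    ... | yes ∣p∣≡0 rewrite ∣p∣≡0⇒p≡⊥ p ∣p∣≡0 = C-mono-≤ {m′ = suc d} (s≤s z≤n) ⋃⊥∈C₁
    ... | no ∣p∣≢0 = nonempty-⋃∈C (suc d) p (n≢0⇒n>0 ∣p∣≢0) ∣p∣≤2^[1+d]

    ⋃∈C-all : ∀ d → n ≤ 1 + 3 * 2 ^ suc d → ∀ p → C (2 + d) 𝒰 (⋃ p)
    ⋃∈C-all d n≤1+3H p with ∣ p ∣ ≤? 2 ^ (2 + d)
    ... | yes p-small = ⋃∈C (suc d) p p-small
    ... | no p-large = ⋃ (Sub.∁ p) , ⋃ (Sub.∁ p) , ⋃∁p∈C , ⋃∁p∈C , inj₂ (inj₂ ⋃p≐∁⋃∁p)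
      where
      H = 2 ^ suc d
      ∣∁p∣≤H : ∣ Sub.∁ p ∣ ≤ H
      ∣∁p∣≤H = subst (_≤ H) (sym (∣∁p∣≡n∸∣p∣ p)) (m≤n+o⇒m∸n≤o n ∣ p ∣ (begin
        n                ≤⟨ n≤1+3H ⟩
        1 + 3 * H        ≡⟨ 1+3m≡[1+2m]+m H ⟩
        (1 + 2 * H) + H  ≤⟨ +-monoˡ-≤ H (≰⇒> p-large) ⟩
        ∣ p ∣ + H        ∎))
        where open ≤-Reasoning
      ⋃∁p∈C : C (suc d) 𝒰 (⋃ (Sub.∁ p))
      ⋃∁p∈C = ⋃∈C d (Sub.∁ p) ∣∁p∣≤H
      ⋃p≐∁⋃∁p : ⋃ p ≐ ∁ (⋃ (Sub.∁ p))
      ⋃p≐∁⋃∁p x = trans (sym (not-involutive (⋃ p x))) (cong not (sym (⋃-∁ p x)))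

    S-is-C∞-2 : 3 ≤ n → n ≤ 7 → S-is 𝒰 (C∞ 𝒰) 2
    S-is-C∞-2 3≤n n≤7 = S-is-C∞ 1 (⋃∈C-all 0 n≤7) Sub.⊤ (⊤-not-admissible₁ 3≤n)

    S-is-C∞-3+ : ∀ d → 1 + 3 * 2 ^ suc d < n → n ≤ 1 + 3 * 2 ^ (2 + d) → S-is 𝒰 (C∞ 𝒰) (3 + d)
    S-is-C∞-3+ d 1+3H<n n≤1+6H =
      let q , ∣q∣≡1+2H = ∃-subset-of-size (≤-trans 1+2H≤1+3H (<⇒≤ 1+3H<n))
      in S-is-C∞ (2 + d) (⋃∈C-all (suc d) n≤1+6H) q (neither-small-nor-cosmall q 1+3H<n ∣q∣≡1+2H)
      where
      1+2H≤1+3H : 1 + 2 * 2 ^ suc d ≤ 1 + 3 * 2 ^ suc d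
      1+2H≤1+3H = +-monoʳ-≤ 1 (*-monoˡ-≤ (2 ^ suc d) (n≤1+n 2))

n<2^[1+⌊log₂n⌋] : ∀ n → n < 2 ^ suc ⌊log₂ n ⌋
n<2^[1+⌊log₂n⌋] n with 2 ^ suc ⌊log₂ n ⌋ ≤? n
... | no 2^[1+⌊log₂n⌋]≰n = ≰⇒> 2^[1+⌊log₂n⌋]≰n
... | yes 2^[1+⌊log₂n⌋]≤n = ⊥-elim (n≮n _
  (subst (_≤ ⌊log₂ n ⌋) (⌊log₂[2^n]⌋≡n (suc ⌊log₂ n ⌋)) (⌊log₂⌋-mono-≤ 2^[1+⌊log₂n⌋]≤n)))

2^⌊log₂n⌋≤n : ∀ n → 1 ≤ n → 2 ^ ⌊log₂ n ⌋ ≤ n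
2^⌊log₂n⌋≤n = <-rec (λ n → 1 ≤ n → 2 ^ ⌊log₂ n ⌋ ≤ n) step
  where
  2^L≤2h : ∀ L {h} → 1 ≤ L → 2 ^ (L ∸ 1) ≤ h → 2 ^ L ≤ 2 * h
  2^L≤2h (suc L) _ = *-monoʳ-≤ 2
  step : ∀ n → (∀ {m} → m < n → 1 ≤ m → 2 ^ ⌊log₂ m ⌋ ≤ m) → 1 ≤ n → 2 ^ ⌊log₂ n ⌋ ≤ n
  step 1 _ _ = ≤-refl
  step n@(suc (suc k)) rec _ = begin
    2 ^ ⌊log₂ n ⌋        ≤⟨ 2^L≤2h ⌊log₂ n ⌋ (⌊log₂⌋-mono-≤ {2} {n} (s≤s (s≤s z≤n))) 2^⌊log₂n⌋∸1≤⌊n/2⌋ ⟩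
    2 * ⌊ n /2⌋          ≡⟨ 2*m≡m+m ⌊ n /2⌋ ⟩
    ⌊ n /2⌋ + ⌊ n /2⌋    ≤⟨ +-monoʳ-≤ ⌊ n /2⌋ (⌊n/2⌋≤⌈n/2⌉ n) ⟩
    ⌊ n /2⌋ + ⌈ n /2⌉    ≡⟨ ⌊n/2⌋+⌈n/2⌉≡n n ⟩
    n                    ∎
    where
    open ≤-Reasoning
    2^⌊log₂n⌋∸1≤⌊n/2⌋ : 2 ^ (⌊log₂ n ⌋ ∸ 1) ≤ ⌊ n /2⌋
    2^⌊log₂n⌋∸1≤⌊n/2⌋ =
      subst (λ L → 2 ^ L ≤ ⌊ n /2⌋) (⌊log₂⌊n/2⌋⌋≡⌊log₂n⌋∸1 n) (rec (⌊n/2⌋<n (suc k)) (s≤s z≤n))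

n≤2^⌈log₂n⌉ : ∀ n → 1 ≤ n → n ≤ 2 ^ ⌈log₂ n ⌉
n≤2^⌈log₂n⌉ = <-rec (λ n → 1 ≤ n → n ≤ 2 ^ ⌈log₂ n ⌉) step
  where
  2h≤2^L : ∀ L {h} → 1 ≤ L → h ≤ 2 ^ (L ∸ 1) → 2 * h ≤ 2 ^ L
  2h≤2^L (suc L) _ = *-monoʳ-≤ 2
  step : ∀ n → (∀ {m} → m < n → 1 ≤ m → m ≤ 2 ^ ⌈log₂ m ⌉) → 1 ≤ n → n ≤ 2 ^ ⌈log₂ n ⌉
  step 1 _ _ = ≤-refl
  step n@(suc (suc k)) rec _ = begin
    n                    ≡⟨ sym (⌊n/2⌋+⌈n/2⌉≡n n) ⟩
    ⌊ n /2⌋ + ⌈ n /2⌉    ≤⟨ +-monoˡ-≤ ⌈ n /2⌉ (⌊n/2⌋≤⌈n/2⌉ n) ⟩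
    ⌈ n /2⌉ + ⌈ n /2⌉    ≡⟨ sym (2*m≡m+m ⌈ n /2⌉) ⟩
    2 * ⌈ n /2⌉          ≤⟨ 2h≤2^L ⌈log₂ n ⌉ (⌈log₂⌉-mono-≤ {2} {n} (s≤s (s≤s z≤n))) ⌈n/2⌉≤2^⌈log₂n⌉∸1 ⟩
    2 ^ ⌈log₂ n ⌉        ∎
    where
    open ≤-Reasoning
    ⌈n/2⌉≤2^⌈log₂n⌉∸1 : ⌈ n /2⌉ ≤ 2 ^ (⌈log₂ n ⌉ ∸ 1)
    ⌈n/2⌉≤2^⌈log₂n⌉∸1 =
      subst (λ L → ⌈ n /2⌉ ≤ 2 ^ L) (⌈log₂⌈n/2⌉⌉≡⌈log₂n⌉∸1 n) (rec (⌈n/2⌉<n k) (s≤s z≤n))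

⌈log₂n⌉≡1+k : ∀ {n k} → 2 ^ k < n → n ≤ 2 ^ suc k → ⌈log₂ n ⌉ ≡ suc k
⌈log₂n⌉≡1+k {n} {k} 2^k<n n≤2^[1+k] = ≤-antisym ⌈log₂n⌉≤1+k 1+k≤⌈log₂n⌉
  where
  ⌈log₂n⌉≤1+k : ⌈log₂ n ⌉ ≤ suc k
  ⌈log₂n⌉≤1+k = subst (⌈log₂ n ⌉ ≤_) (⌈log₂2^n⌉≡n (suc k)) (⌈log₂⌉-mono-≤ n≤2^[1+k])
  1+k≤⌈log₂n⌉ : suc k ≤ ⌈log₂ n ⌉
  1+k≤⌈log₂n⌉ with suc k ≤? ⌈log₂ n ⌉
  ... | yes 1+k≤⌈log₂n⌉ = 1+k≤⌈log₂n⌉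
  ... | no 1+k≰⌈log₂n⌉ = ⊥-elim (<⇒≱ 2^k<n (begin
    n                ≤⟨ n≤2^⌈log₂n⌉ n (≤-trans (m^n>0 2 k) (<⇒≤ 2^k<n)) ⟩
    2 ^ ⌈log₂ n ⌉    ≤⟨ ^-monoʳ-≤ 2 (s≤s⁻¹ (≰⇒> 1+k≰⌈log₂n⌉)) ⟩
    2 ^ k            ∎))
    where open ≤-Reasoning

2^[1+m]≤1+3*2^m : ∀ m → 2 ^ suc m ≤ 1 + 3 * 2 ^ m
2^[1+m]≤1+3*2^m m = m≤n⇒m≤1+n (*-monoˡ-≤ (2 ^ m) (n≤1+n 2))

1+3*2^[1+d]<2^[3+d] : ∀ d → 1 + 3 * 2 ^ suc d < 2 ^ (3 + d)
1+3*2^[1+d]<2^[3+d] d = begin-strict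
  1 + 3 * H    <⟨ n<1+n _ ⟩
  2 + 3 * H    ≤⟨ +-monoˡ-≤ (3 * H) (^-monoʳ-≤ 2 {1} {suc d} (s≤s z≤n)) ⟩
  H + 3 * H    ≡⟨ H+3H≡2*[2*H] H ⟩
  2 * (2 * H)  ∎
  where
  open ≤-Reasoning
  H = 2 ^ suc d
  H+3H≡2*[2*H] : ∀ H → H + 3 * H ≡ 2 * (2 * H)
  H+3H≡2*[2*H] = solve-∀

theorem5p16 : (X : Set) (n : ℕ) (A : Fin n → Subset X) → IsPartition A → 4 ≤ n →
    (n ≤ 1 + 3 * 2 ^ (⌊log₂ n ⌋ ∸ 1) → S-is (familyOf A) (C∞ (familyOf A)) ⌊log₂ n ⌋)
    × (n > 1 + 3 * 2 ^ (⌊log₂ n ⌋ ∸ 1) → S-is (familyOf A) (C∞ (familyOf A)) ⌈log₂ n ⌉)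
theorem5p16 X n@(suc (suc _)) A partition 4≤n =
  floor-case ⌊log₂ n ⌋ 2≤⌊log₂n⌋ (2^⌊log₂n⌋≤n n (s≤s z≤n)) ,
  ceil-case ⌊log₂ n ⌋ 2≤⌊log₂n⌋ (n<2^[1+⌊log₂n⌋] n)
  where
  open Partition A partition
  0≢1 : _≢_ {A = Fin n} zero (suc zero)
  0≢1 ()
  2≤⌊log₂n⌋ : 2 ≤ ⌊log₂ n ⌋
  2≤⌊log₂n⌋ = ⌊log₂⌋-mono-≤ {4} {n} 4≤n
  floor-case : ∀ L → 2 ≤ L → 2 ^ L ≤ n → n ≤ 1 + 3 * 2 ^ (L ∸ 1) → S-is 𝒰 (C∞ 𝒰) L
  floor-case 2 _ _ = S-is-C∞-2 0≢1 (≤-trans (n≤1+n 3) 4≤n)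
  floor-case (suc (suc (suc d))) _ 2^L≤n = S-is-C∞-3+ 0≢1 d (<-≤-trans (1+3*2^[1+d]<2^[3+d] d) 2^L≤n)
  floor-case 1 (s≤s ())
  ceil-case : ∀ L → 2 ≤ L → n < 2 ^ suc L → 1 + 3 * 2 ^ (L ∸ 1) < n → S-is 𝒰 (C∞ 𝒰) ⌈log₂ n ⌉
  ceil-case L@(suc (suc d)) _ n<2^[1+L] 1+3*2^[L-1]<n =
    subst (S-is 𝒰 (C∞ 𝒰)) (sym ⌈log₂n⌉≡3+d)
      (S-is-C∞-3+ 0≢1 d 1+3*2^[L-1]<n (≤-trans (<⇒≤ n<2^[1+L]) (2^[1+m]≤1+3*2^m L)))
    where
    ⌈log₂n⌉≡3+d = ⌈log₂n⌉≡1+k (≤-<-trans (2^[1+m]≤1+3*2^m (suc d)) 1+3*2^[L-1]<n) (<⇒≤ n<2^[1+L])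
  ceil-case 1 (s≤s ())
theorem5p16 X 1 A partition (s≤s ())
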